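{- Let $k\in\mathbb N$ and $S\subseteq R^k_{\{0,1\}}$. If $\rho$ is a canonical relation with $\rho\in\langle S\rangle_{\mathrm{qpp}}$ and $\rho\notin\mathrm{EO}_5(S)$, then $\rho$ is not a canonical relation of type (c7). In particular, there are only finitely many relations $\rho$ that are canonical, lie in $\langle S\rangle_{\mathrm{qpp}}$ and do not lie in $\mathrm{EO}_5(S)$.
   Context: $E_k=\{1,\dots,k\}$. $R^k_{\{0,1\}}$ is the set of $k$-sorted relations on $\{0,1\}$: subsets of $\{0,1\}^n$ (predicates) with each variable assigned a sort in $E_k$ (superscripts denote sorts, arithmetic mod 2). $\sigma_\bot$ is the empty $0$-ary relation and $\sigma^i_=$ equality on sort $i$. $\langle S\rangle_{\mathrm{qpp}}$ is the set of relations definable by formulas built from predicates in $S\cup\{\sigma_\bot,\sigma_=^1,\dots,\sigma_=^k\}$ using conjunction, existential and universal quantification only, each variable having one sort and substituted only into positions of that sort. A variable is dummy if the predicate does not depend on it. Elementary operations: (eo1) appending or removing a dummy variable; (eo2) permuting variables; (eo3) identifying the first two variables when they have the same sort; (eo4) composition: for $\rho_1,\rho_2$ whose first variables are non-dummy and of the same sort, $\rho'(x_1,\dots,x_{n-1},y_1,\dots,y_{m-1})=\exists z\,\rho_1(z,x_1,\dots,x_{n-1})\land\rho_2(z,y_1,\dots,y_{m-1})$; (eo5) $\rho'(x_1,\dots,x_{n-1})=\forall y\,\rho(y,x_1,\dots,x_{n-1})$. $\mathrm{EO}_5(S)$ is the set of relations obtainable from elements of $S\cup\{\sigma_\bot,\sigma_=^1,\dots,\sigma_=^k\}$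 by sequences of operations (eo1)–(eo5). A $k$-sorted relation without dummy variables is canonical if, up to order of variables, it equals one of: (c1) $x^i=0\lor y^i=1$; (c2) $x^i=y^i\lor u^j=b$; (c3) $x^i=y^i\lor u^j=v^j$ with $i\ne j$, or $x^i=y^i\lor y^i=z^i$; (c4) $x^i+y^i=1$; (c5) $x^i+y^i=u^j+v^j$; (c6) $x^{s_1}+\dots+x^{s_n}=b$ with $n\ge2$ and $s_1,\dots,s_n$ pairwise distinct; (c7) $\bigvee_{t=1}^{n}\bigvee_{p=1}^{m_t}(x_p^{s_t}=b_t)$ with $s_1,\dots,s_n$ pairwise distinct; here $i,j,s_t\in E_k$ and $b,b_t\in\{0,1\}$. -}

module Defs where

open import Data.Nat using (ℕ; zero; suc; _+_; _≤_)
open import Data.Bool using (Bool; true; false; _∧_; _∨_; not; _xor_; if_then_else_)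
open import Data.Bool.Properties using () renaming (_≟_ to _≟B_)
open import Data.Fin using (Fin)
open import Data.Vec using (Vec; []; _∷_; lookup; tabulate; _++_; take; drop; replicate; map; _[_]≔_; foldr′; fromList)
open import Data.List using (List; length) renaming (map to mapL; [] to []L; _∷_ to _∷L_)
open import Data.List.Relation.Unary.Unique.Propositional using (Unique)
open import Data.Product using (Σ; _×_; _,_; proj₁)
open import Data.Sum using (_⊎_)
open import Data.Fin.Permutation using (Permutation′; _⟨$⟩ʳ_; _⟨$⟩ˡ_)
open import Relation.Binary.PropositionalEquality using (_≡_; _≢_)
open import Relation.Nullary using (¬_; does)

-- k-sorted relations on {0,1} (false = 0, true = 1).
-- A relation has an arity n, a sort (element of E_k, encoded as Fin k)
-- for each variable, and a (decidable) predicate on {0,1}^n.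

record Rel (k : ℕ) : Set where
  constructor rel
  field
    arity : ℕ
    sorts : Vec (Fin k) arity
    pred  : Vec Bool arity → Bool
open Rel public

data _≈R_ {k : ℕ} : Rel k → Rel k → Set where
  mk≈ : ∀ {n} {ss : Vec (Fin k) n} {p q : Vec Bool n → Bool} →
        (∀ v → p v ≡ q v) → rel n ss p ≈R rel n ss q

_==_ : Bool → Bool → Bool
a == b = does (a ≟B b)

Dummy : ∀ {k} (ρ : Rel k) → Fin (arity ρ) → Set
Dummy ρ i = ∀ v b → pred ρ v ≡ pred ρ (v [ i ]≔ b)

NoDummy : ∀ {k} → Rel k → Set
NoDummy ρ = ∀ i → ¬ Dummy ρ i

permute : ∀ {k} (ρ : Rel k) → Permutation′ (arity ρ) → Rel k
permute (rel n ss p) π =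
  rel n (tabulate (λ i → lookup ss (π ⟨$⟩ˡ i)))
        (λ v → p (tabulate (λ j → lookup v (π ⟨$⟩ʳ j))))

σ⊥ : ∀ {k} → Rel k
σ⊥ = rel 0 [] (λ _ → false)

σ= : ∀ {k} → Fin k → Rel k
σ= i = rel 2 (i ∷ i ∷ []) (λ { (x ∷ y ∷ []) → x == y })

-- ⟨S⟩_qpp : formulas over a context of sorted variables (de Bruijn,
-- bound variable = position 0), built from atoms of S ∪ {σ⊥, σ^i_=}
-- with ∧, ∃, ∀.

Allowed : ∀ {k} → (Rel k → Set) → Rel k → Set
Allowed S r = S r ⊎ (r ≡ σ⊥ ⊎ Σ _ λ i → r ≡ σ= i)

data Formula {k : ℕ} (S : Rel k → Set) : {m : ℕ} → Vec (Fin k) m → Set where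
  atom : ∀ {m} {Γ : Vec (Fin k) m} (r : Rel k) → Allowed S r →
         (f : Vec (Fin m) (arity r)) →
         (∀ j → lookup Γ (lookup f j) ≡ lookup (sorts r) j) → Formula S Γ
  and  : ∀ {m} {Γ : Vec (Fin k) m} → Formula S Γ → Formula S Γ → Formula S Γ
  ex   : ∀ {m} {Γ : Vec (Fin k) m} (s : Fin k) → Formula S (s ∷ Γ) → Formula S Γ
  all  : ∀ {m} {Γ : Vec (Fin k) m} (s : Fin k) → Formula S (s ∷ Γ) → Formula S Γ

eval : ∀ {k} {S : Rel k → Set} {m} {Γ : Vec (Fin k) m} → Formula S Γ → Vec Bool m → Bool
eval (atom r _ f _) env = pred r (map (lookup env) f)
eval (and φ ψ) env = eval φ env ∧ eval ψ env
eval (ex s φ) env = eval φ (false ∷ env) ∨ eval φ (true ∷ env)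
eval (all s φ) env = eval φ (false ∷ env) ∧ eval φ (true ∷ env)

InQpp : ∀ {k} → (Rel k → Set) → Rel k → Set
InQpp S ρ = Σ (Formula S (sorts ρ)) λ φ → ∀ v → eval φ v ≡ pred ρ v

-- EO_5(S): closure of S ∪ {σ⊥, σ^1_=, …, σ^k_=} under (eo1)–(eo5)
-- (dummy variables are appended/removed at the first position; together
-- with permutations (eo2) this covers any position).

data EO5 {k : ℕ} (S : Rel k → Set) : Rel k → Set where
  base   : ∀ {r} → S r → EO5 S r
  bot    : EO5 S σ⊥
  eq     : ∀ i → EO5 S (σ= i)
  resp   : ∀ {r r'} → EO5 S r → r ≈R r' → EO5 S r'
  addD   : ∀ {n ss p} (s : Fin k) → EO5 S (rel n ss p) →
           EO5 S (rel (suc n) (s ∷ ss) (λ { (_ ∷ v) → p v }))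
  remD   : ∀ {n s ss p} → EO5 S (rel (suc n) (s ∷ ss) p) →
           Dummy (rel (suc n) (s ∷ ss) p) Fin.zero →
           EO5 S (rel n ss (λ v → p (false ∷ v)))
  perm   : ∀ {r} (π : Permutation′ (arity r)) → EO5 S r → EO5 S (permute r π)
  ident  : ∀ {n s ss p} → EO5 S (rel (suc (suc n)) (s ∷ s ∷ ss) p) →
           EO5 S (rel (suc n) (s ∷ ss) (λ { (b ∷ v) → p (b ∷ b ∷ v) }))
  comp   : ∀ {n m s ss tt p q} →
           EO5 S (rel (suc n) (s ∷ ss) p) → EO5 S (rel (suc m) (s ∷ tt) q) →
           ¬ Dummy (rel (suc n) (s ∷ ss) p) Fin.zero →
           ¬ Dummy (rel (suc m) (s ∷ tt) q) Fin.zero →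
           EO5 S (rel (n + m) (ss ++ tt)
             (λ v → (p (false ∷ take n v) ∧ q (false ∷ drop n v))
                  ∨ (p (true ∷ take n v) ∧ q (true ∷ drop n v))))
  univ   : ∀ {n s ss p} → EO5 S (rel (suc n) (s ∷ ss) p) →
           EO5 S (rel n ss (λ v → p (false ∷ v) ∧ p (true ∷ v)))

-- Canonical relations (listed variables in the order written in the paper)

C1 : ∀ {k} → Fin k → Rel k
C1 i = rel 2 (i ∷ i ∷ []) (λ { (x ∷ y ∷ []) → not x ∨ y })

C2 : ∀ {k} → Fin k → Fin k → Bool → Rel k
C2 i j b = rel 3 (i ∷ i ∷ j ∷ []) (λ { (x ∷ y ∷ u ∷ []) → (x == y) ∨ (u == b) })

C3a : ∀ {k} → Fin k → Fin k → Rel k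
C3a i j = rel 4 (i ∷ i ∷ j ∷ j ∷ []) (λ { (x ∷ y ∷ u ∷ w ∷ []) → (x == y) ∨ (u == w) })

C3b : ∀ {k} → Fin k → Rel k
C3b i = rel 3 (i ∷ i ∷ i ∷ []) (λ { (x ∷ y ∷ z ∷ []) → (x == y) ∨ (y == z) })

C4 : ∀ {k} → Fin k → Rel k
C4 i = rel 2 (i ∷ i ∷ []) (λ { (x ∷ y ∷ []) → (x xor y) == true })

C5 : ∀ {k} → Fin k → Fin k → Rel k
C5 i j = rel 4 (i ∷ i ∷ j ∷ j ∷ []) (λ { (x ∷ y ∷ u ∷ w ∷ []) → (x xor y) == (u xor w) })

C6 : ∀ {k} → List (Fin k) → Bool → Rel k
C6 L b = rel (length L) (fromList L) (λ v → foldr′ _xor_ false v == b)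

-- (c7) ⋁_t ⋁_{p ≤ m_t} (x^{s_t}_p = b_t); blocks given as a list of (s_t , m_t , b_t)
C7arity : ∀ {k} → List (Fin k × ℕ × Bool) → ℕ
C7arity []L = 0
C7arity ((_ , m , _) ∷L B) = m + C7arity B

C7sorts : ∀ {k} (B : List (Fin k × ℕ × Bool)) → Vec (Fin k) (C7arity B)
C7sorts []L = []
C7sorts ((s , m , _) ∷L B) = replicate m s ++ C7sorts B

anyEq : ∀ {m} → Bool → Vec Bool m → Bool
anyEq b [] = false
anyEq b (x ∷ v) = (x == b) ∨ anyEq b v

C7pred : ∀ {k} (B : List (Fin k × ℕ × Bool)) → Vec Bool (C7arity B) → Bool
C7pred []L _ = false
C7pred ((_ , m , b) ∷L B) v = anyEq b (take m v) ∨ C7pred B (drop m v)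

C7 : ∀ {k} → List (Fin k × ℕ × Bool) → Rel k
C7 B = rel (C7arity B) (C7sorts B) (C7pred B)

data Basic {k : ℕ} : Rel k → Set where
  c1  : ∀ i → Basic (C1 i)
  c2  : ∀ i j b → Basic (C2 i j b)
  c3a : ∀ i j → i ≢ j → Basic (C3a i j)
  c3b : ∀ i → Basic (C3b i)
  c4  : ∀ i → Basic (C4 i)
  c5  : ∀ i j → Basic (C5 i j)
  c6  : ∀ (L : List (Fin k)) b → 2 ≤ length L → Unique L → Basic (C6 L b)
  c7  : ∀ (B : List (Fin k × ℕ × Bool)) → Unique (mapL proj₁ B) → Basic (C7 B)

UpToOrder : ∀ {k} → (Rel k → Set) → Rel k → Set
UpToOrder P ρ = Σ _ λ r → P r × Σ (Permutation′ (arity r)) λ π → ρ ≈R permute r π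

Canonical : ∀ {k} → Rel k → Set
Canonical ρ = NoDummy ρ × UpToOrder Basic ρ

IsC7 : ∀ {k} → Rel k → Set
IsC7 ρ = Canonical ρ × UpToOrder (λ r → Σ _ λ B → Unique (mapL proj₁ B) × r ≡ C7 B) ρ

{-# OPTIONS --safe #-}
-- A relation of type (c7) is false at exactly one tuple. If a qpp formula φ is false at a
-- tuple a, induction on φ gives a separator: some t ∈ EO₅(S) with φ ⊆ t and t(a) = 0. An
-- atom is its own separator, since EO₅(S) is closed under minors (add dummies, permute,
-- identify); for φ ∧ ψ take the separator of a false conjunct, for ∀ apply (eo5) to the
-- separator of a false instance, and for ∃ compose the separators of both instances with
-- (eo4). If ρ ∈ ⟨S⟩_qpp has a unique falsifying tuple, its separator is ρ itself. Every
-- other canonical relation has at most k + 4 variables (the sorts in (c6) are distinct),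
-- and up to equality there are finitely many relations of bounded arity.

module Submission where

open import Defs
open import Data.Nat using (ℕ; zero; suc; _+_; _≤_; z≤n; s≤s)
open import Data.Nat.Properties using (≮⇒≥; m≤m+n; m≤n+m; ≤-trans)
open import Data.Bool using (Bool; true; false; _∧_; _∨_; not; if_then_else_)
open import Data.Bool.Properties using (∧-zeroʳ; ∨-zeroʳ; ∧-conicalˡ; ∧-conicalʳ; ∨-conicalˡ; ∨-conicalʳ)
  renaming (_≟_ to _≟B_)
open import Data.Fin using (Fin; zero; suc; _<_; _↑ʳ_; splitAt)
open import Data.Fin.Properties using (+↔⊎; splitAt-join; pigeonhole)
open import Data.Fin.Permutation
  using (Permutation; Permutation′; ↔⇒≡; _⟨$⟩ʳ_; _⟨$⟩ˡ_; inverseˡ; inverseʳ; insert; flip)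
  renaming (id to idₚ)
open import Data.Vec
  using (Vec; []; _∷_; lookup; tabulate; _++_; take; drop; map; insertAt; removeAt; head; tail;
         allFin; replicate; _[_]≔_)
open import Data.Vec.Properties
  using (lookup∘tabulate; insertAt-lookup; insertAt-punchIn; insertAt-removeAt; lookup-++ʳ; lookup-map;
         map-++; map-lookup-allFin; lookup-splitAt; take++drop≡id; ++-injective)
open import Data.Vec.Relation.Binary.Pointwise.Extensional using (ext; Pointwise-≡⇒≡)
open import Data.Sum using (inj₁; inj₂; [_,_]′; swap)
open import Data.Sum.Properties using (swap-↔)
open import Data.Product using (Σ; _×_; _,_; proj₁; proj₂)
open import Data.List using (List; length; upTo; concatMap; cartesianProductWith)
  renaming ([] to []ᴸ; _∷_ to _∷ᴸ_)
import Data.List as List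
open import Data.List.Relation.Unary.Any using (Any; here; there)
import Data.List.Relation.Unary.Any as Any
open import Data.List.Relation.Unary.Any.Properties using (concatMap⁺; cartesianProductWith⁺)
import Data.List.Relation.Unary.All as All
open import Data.List.Relation.Unary.AllPairs using (_∷_)
open import Data.List.Relation.Unary.Unique.Propositional using (Unique)
open import Data.List.Membership.Propositional using (_∈_)
open import Data.List.Membership.Propositional.Properties using (∈-allFin; ∈-upTo⁺; ∈-lookup)
open import Function.Construct.Composition using (_↔-∘_)
open import Function.Construct.Symmetry using (↔-sym)
open import Relation.Binary.PropositionalEquality
  using (_≡_; _≢_; refl; sym; trans; cong; cong₂; subst; module ≡-Reasoning)
open import Relation.Nullary using (¬_; Dec; yes; no)
open import Relation.Nullary.Decidable using (map′)
open import Relation.Unary using (Decidable)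
open import Data.Empty using (⊥-elim)

vec-ext : ∀ {A : Set} {n} {xs ys : Vec A n} → (∀ i → lookup xs i ≡ lookup ys i) → xs ≡ ys
vec-ext xs≗ys = Pointwise-≡⇒≡ (ext xs≗ys)

module _ {A : Set} {m n} (xs : Vec A m) (ys : Vec A n) where

  ++-split : xs ≡ take m (xs ++ ys) × ys ≡ drop m (xs ++ ys)
  ++-split = ++-injective xs _ (proj₂ (proj₂ (Data.Vec.splitAt m (xs ++ ys))))

  take-++ : take m (xs ++ ys) ≡ xs
  take-++ = sym (proj₁ ++-split)

  drop-++ : drop m (xs ++ ys) ≡ ys
  drop-++ = sym (proj₂ ++-split)

blockSwap : ∀ m n → Permutation (m + n) (n + m)
blockSwap m n = ↔-sym (+↔⊎ {n} {m}) ↔-∘ (swap-↔ ↔-∘ +↔⊎ {m} {n})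

lookup-blockSwap : ∀ {A : Set} m n (w : Vec A (n + m)) i →
                   lookup (drop n w ++ take n w) i ≡ lookup w (blockSwap m n ⟨$⟩ʳ i)
lookup-blockSwap m n w i = begin
  lookup (drop n w ++ take n w) i
    ≡⟨ lookup-splitAt m (drop n w) (take n w) i ⟩
  [ lookup (drop n w) , lookup (take n w) ]′ (splitAt m i)
    ≡⟨ swap-cases (splitAt m i) ⟩
  [ lookup (take n w) , lookup (drop n w) ]′ (swap (splitAt m i))
    ≡⟨ cong [ lookup (take n w) , lookup (drop n w) ]′ (splitAt-join n m (swap (splitAt m i))) ⟨
  [ lookup (take n w) , lookup (drop n w) ]′ (splitAt n (blockSwap m n ⟨$⟩ʳ i))
    ≡⟨ lookup-splitAt n (take n w) (drop n w) _ ⟨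
  lookup (take n w ++ drop n w) (blockSwap m n ⟨$⟩ʳ i)
    ≡⟨ cong (λ xs → lookup xs (blockSwap m n ⟨$⟩ʳ i)) (take++drop≡id n w) ⟩
  lookup w (blockSwap m n ⟨$⟩ʳ i) ∎
  where
  open ≡-Reasoning
  swap-cases : ∀ x → [ lookup (drop n w) , lookup (take n w) ]′ x
                   ≡ [ lookup (take n w) , lookup (drop n w) ]′ (swap x)
  swap-cases (inj₁ _) = refl
  swap-cases (inj₂ _) = refl

toFront : ∀ {N} → Fin (suc N) → Permutation′ (suc N)
toFront j = insert zero j idₚ

lookup-insertAt-toFront : ∀ {A : Set} {N} (ys : Vec A N) j b i →
                          lookup (insertAt ys j b) (toFront j ⟨$⟩ʳ i) ≡ lookup (b ∷ ys) i
lookup-insertAt-toFront ys j b zero    = insertAt-lookup ys j b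
lookup-insertAt-toFront ys j b (suc i) = insertAt-punchIn ys j b i

all-Bool? : {P : Bool → Set} → Decidable P → Dec (∀ b → P b)
all-Bool? P? with P? false | P? true
... | yes p₀ | yes p₁ = yes λ { false → p₀ ; true → p₁ }
... | no ¬p₀ | _      = no λ p → ¬p₀ (p false)
... | yes _  | no ¬p₁ = no λ p → ¬p₁ (p true)

all-Vec-Bool? : ∀ n {P : Vec Bool n → Set} → Decidable P → Dec (∀ v → P v)
all-Vec-Bool? zero    P? = map′ (λ p → λ { [] → p }) (λ p → p []) (P? [])
all-Vec-Bool? (suc n) P? =
  map′ (λ p → λ { (b ∷ v) → p b v }) (λ p b v → p (b ∷ v))
       (all-Bool? λ b → all-Vec-Bool? n λ v → P? (b ∷ v))

dummy? : ∀ {k} (ρ : Rel k) i → Dec (Dummy ρ i)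
dummy? ρ i = all-Vec-Bool? (arity ρ) λ v → all-Bool? λ b → pred ρ v ≟B pred ρ (v [ i ]≔ b)

HasUniqueFalsifier : ∀ {k} → Rel k → Set
HasUniqueFalsifier ρ =
  Σ (Vec Bool (arity ρ)) λ a → pred ρ a ≡ false × (∀ v → pred ρ v ≡ false → v ≡ a)

≈R-HasUniqueFalsifier : ∀ {k} {ρ ρ′ : Rel k} →
                        ρ ≈R ρ′ → HasUniqueFalsifier ρ′ → HasUniqueFalsifier ρ
≈R-HasUniqueFalsifier (mk≈ p≗q) (a , qa , unique) =
  a , trans (p≗q a) qa , λ v pv → unique v (trans (sym (p≗q v)) pv)

permute-HasUniqueFalsifier : ∀ {k} {r : Rel k} (π : Permutation′ (arity r)) →
                             HasUniqueFalsifier r → HasUniqueFalsifier (permute r π)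
permute-HasUniqueFalsifier {r = rel n ss p} π (a , pa , unique) =
  a′ , trans (cong p (vec-ext a′-at-π)) pa , λ v pv → vec-ext (v-at v (unique _ pv))
  where
  a′ : Vec Bool n
  a′ = tabulate λ i → lookup a (π ⟨$⟩ˡ i)
  a′-at-π : ∀ j → lookup (tabulate λ j → lookup a′ (π ⟨$⟩ʳ j)) j ≡ lookup a j
  a′-at-π j = trans (lookup∘tabulate _ j)
                    (trans (lookup∘tabulate _ (π ⟨$⟩ʳ j)) (cong (lookup a) (inverseˡ π)))
  v-at : ∀ v → tabulate (λ j → lookup v (π ⟨$⟩ʳ j)) ≡ a → ∀ i → lookup v i ≡ lookup a′ i
  v-at v v∘π≡a i = begin
    lookup v i
      ≡⟨ cong (lookup v) (inverseʳ π) ⟨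
    lookup v (π ⟨$⟩ʳ (π ⟨$⟩ˡ i))
      ≡⟨ lookup∘tabulate _ (π ⟨$⟩ˡ i) ⟨
    lookup (tabulate λ j → lookup v (π ⟨$⟩ʳ j)) (π ⟨$⟩ˡ i)
      ≡⟨ cong (λ xs → lookup xs (π ⟨$⟩ˡ i)) v∘π≡a ⟩
    lookup a (π ⟨$⟩ˡ i)
      ≡⟨ lookup∘tabulate _ i ⟨
    lookup a′ i ∎
    where open ≡-Reasoning

anyEq-replicate-not : ∀ m b → anyEq b (replicate m (not b)) ≡ false
anyEq-replicate-not zero    b     = refl
anyEq-replicate-not (suc m) false = anyEq-replicate-not m false
anyEq-replicate-not (suc m) true  = anyEq-replicate-not m true

anyEq≡false⇒replicate-not : ∀ {m} b (u : Vec Bool m) → anyEq b u ≡ false → u ≡ replicate m (not b)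
anyEq≡false⇒replicate-not b     []          _  = refl
anyEq≡false⇒replicate-not false (true ∷ u)  ¬u =
  cong (true ∷_) (anyEq≡false⇒replicate-not false u ¬u)
anyEq≡false⇒replicate-not true  (false ∷ u) ¬u =
  cong (false ∷_) (anyEq≡false⇒replicate-not true u ¬u)

C7-falsifier : ∀ {k} (B : List (Fin k × ℕ × Bool)) → Vec Bool (C7arity B)
C7-falsifier []ᴸ               = []
C7-falsifier ((_ , m , b) ∷ᴸ B) = replicate m (not b) ++ C7-falsifier B

C7-HasUniqueFalsifier : ∀ {k} (B : List (Fin k × ℕ × Bool)) → HasUniqueFalsifier (C7 B)
C7-HasUniqueFalsifier B = C7-falsifier B , falsified B , unique B
  where
  falsified : ∀ B → C7pred B (C7-falsifier B) ≡ false
  falsified []ᴸ = refl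
  falsified ((_ , m , b) ∷ᴸ B)
    rewrite take-++ (replicate m (not b)) (C7-falsifier B) | drop-++ (replicate m (not b)) (C7-falsifier B)
          | anyEq-replicate-not m b = falsified B
  unique : ∀ B w → C7pred B w ≡ false → w ≡ C7-falsifier B
  unique []ᴸ [] _ = refl
  unique ((_ , m , b) ∷ᴸ B) w ¬w = begin
    w                           ≡⟨ take++drop≡id m w ⟨
    take m w ++ drop m w        ≡⟨ cong₂ _++_ (anyEq≡false⇒replicate-not b _ (∨-conicalˡ _ _ ¬w))
                                              (unique B _ (∨-conicalʳ _ _ ¬w)) ⟩
    replicate m (not b) ++ C7-falsifier B ∎
    where open ≡-Reasoning

IsC7⇒HasUniqueFalsifier : ∀ {k} {ρ : Rel k} → IsC7 ρ → HasUniqueFalsifier ρ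
IsC7⇒HasUniqueFalsifier (_ , _ , (B , _ , refl) , π , ρ≈) =
  ≈R-HasUniqueFalsifier ρ≈ (permute-HasUniqueFalsifier {r = C7 B} π (C7-HasUniqueFalsifier B))

module _ {k : ℕ} (S : Rel k → Set) where

  EO5′ : ∀ {n} → Vec (Fin k) n → (Vec Bool n → Bool) → Set
  EO5′ ss p = EO5 S (rel _ ss p)

  EO5′-cast : ∀ {n} {ss ss′ : Vec (Fin k) n} {p q} →
              EO5′ ss p → ss ≡ ss′ → (∀ v → p v ≡ q v) → EO5′ ss′ q
  EO5′-cast e refl p≗q = resp e (mk≈ p≗q)

  -- (eo2) for a bijection Fin N ↔ Fin N′, so that the block swap Fin (m + n) ↔ Fin (n + m)
  -- can be used without transporting along m + n ≡ n + m.
  reindex : ∀ {N N′} (π : Permutation N N′) (rearrange : ∀ {A : Set} → Vec A N′ → Vec A N) →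
            (∀ {A : Set} (w : Vec A N′) i → lookup (rearrange w) i ≡ lookup w (π ⟨$⟩ʳ i)) →
            ∀ {ts p} → EO5′ (rearrange ts) p → EO5′ ts (λ w → p (rearrange w))
  reindex π rearrange lookup-rearrange {ts} {p} e with ↔⇒≡ π
  ... | refl = EO5′-cast (perm π e) sorts-eq (λ w → cong p (values-eq w))
    where
    values-eq : ∀ {A : Set} (w : Vec A _) → tabulate (λ i → lookup w (π ⟨$⟩ʳ i)) ≡ rearrange w
    values-eq w = vec-ext λ i → trans (lookup∘tabulate _ i) (sym (lookup-rearrange w i))
    sorts-eq : tabulate (λ i → lookup (rearrange ts) (π ⟨$⟩ˡ i)) ≡ ts
    sorts-eq = vec-ext λ i →
      trans (lookup∘tabulate _ i) (trans (lookup-rearrange ts _) (cong (lookup ts) (inverseʳ π)))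

  moveToFront : ∀ {N} {ts : Vec (Fin k) (suc N)} {p} (j : Fin (suc N)) → EO5′ ts p →
                EO5′ (lookup ts j ∷ removeAt ts j) (λ v → p (insertAt (tail v) j (head v)))
  moveToFront {ts = ts} j e =
    reindex (flip (toFront j)) (λ v → insertAt (tail v) j (head v)) lookup-insertAt
            (EO5′-cast e (sym (insertAt-removeAt ts j)) λ _ → refl)
    where
    lookup-insertAt : ∀ {A : Set} (w : Vec A _) i →
                      lookup (insertAt (tail w) j (head w)) i ≡ lookup w (toFront j ⟨$⟩ˡ i)
    lookup-insertAt (b ∷ ys) i =
      trans (cong (lookup (insertAt ys j b)) (sym (inverseʳ (toFront j))))
            (lookup-insertAt-toFront ys j b (toFront j ⟨$⟩ˡ i))

  moveFromFront : ∀ {N} {ts : Vec (Fin k) (suc N)} {p} (j : Fin (suc N)) →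
                  EO5′ (lookup ts j ∷ removeAt ts j) p →
                  EO5′ ts (λ w → p (lookup w j ∷ removeAt w j))
  moveFromFront j = reindex (toFront j) (λ w → lookup w j ∷ removeAt w j) lookup-front
    where
    lookup-front : ∀ {A : Set} (w : Vec A _) i →
                   lookup (lookup w j ∷ removeAt w j) i ≡ lookup w (toFront j ⟨$⟩ʳ i)
    lookup-front w i =
      trans (sym (lookup-insertAt-toFront (removeAt w j) j (lookup w j) i))
            (cong (λ xs → lookup xs (toFront j ⟨$⟩ʳ i)) (insertAt-removeAt w j))

  identifyFirstWith : ∀ {N} {ts : Vec (Fin k) N} {s p} (j : Fin N) → lookup ts j ≡ s →
                      EO5′ (s ∷ ts) p → EO5′ ts (λ w → p (lookup w j ∷ w))
  identifyFirstWith {ts = _ ∷ _} {p = p} j refl e =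
    EO5′-cast (moveFromFront j (ident (moveToFront (suc j) e))) refl
              λ w → cong (λ xs → p (lookup w j ∷ xs)) (insertAt-removeAt w j)

  addDummiesˡ : ∀ {m n} (Γ : Vec (Fin k) m) {ss : Vec (Fin k) n} {p} →
                EO5′ ss p → EO5′ (Γ ++ ss) (λ v → p (drop m v))
  addDummiesˡ []      e = e
  addDummiesˡ (s ∷ Γ) e = EO5′-cast (addD s (addDummiesˡ Γ e)) refl λ { (_ ∷ _) → refl }

  addDummiesʳ : ∀ {m n} (Γ : Vec (Fin k) m) {ss : Vec (Fin k) n} {p} →
                EO5′ ss p → EO5′ (ss ++ Γ) (λ v → p (take n v))
  addDummiesʳ {m} {n} Γ {ss} {p} e =
    EO5′-cast (reindex (blockSwap m n) (λ w → drop n w ++ take n w) (lookup-blockSwap m n) swapped)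
              refl λ w → cong p (drop-++ (drop n w) (take n w))
    where
    swapped : EO5′ (drop n (ss ++ Γ) ++ take n (ss ++ Γ)) (λ v → p (drop m v))
    swapped = EO5′-cast (addDummiesˡ Γ e) (sym (cong₂ _++_ (drop-++ ss Γ) (take-++ ss Γ))) λ _ → refl

  identifyPrefix : ∀ {n m} {ts : Vec (Fin k) n} {Γ : Vec (Fin k) m} {q} (f : Vec (Fin m) n) →
                   (∀ j → lookup Γ (lookup f j) ≡ lookup ts j) →
                   EO5′ (ts ++ Γ) q → EO5′ Γ (λ v → q (map (lookup v) f ++ v))
  identifyPrefix {ts = []} [] _ e = e
  identifyPrefix {suc n} {ts = t ∷ ts} {Γ} {q} (i ∷ f) f-sorts e =
    EO5′-cast (identifyPrefix f (λ j → f-sorts (suc j)) linked) refl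
              λ v → cong (λ b → q (b ∷ map (lookup v) f ++ v)) (lookup-++ʳ (map (lookup v) f) v i)
    where
    linked : EO5′ (ts ++ Γ) (λ w → q (lookup w (n ↑ʳ i) ∷ w))
    linked = identifyFirstWith (n ↑ʳ i) (trans (lookup-++ʳ ts Γ i) (f-sorts zero)) e

  substitute : ∀ {n m} {ss : Vec (Fin k) n} {Γ : Vec (Fin k) m} {p} (f : Vec (Fin m) n) →
               (∀ j → lookup Γ (lookup f j) ≡ lookup ss j) →
               EO5′ ss p → EO5′ Γ (λ v → p (map (lookup v) f))
  substitute {Γ = Γ} {p} f f-sorts e =
    EO5′-cast (identifyPrefix f f-sorts (addDummiesʳ Γ e)) refl
              λ v → cong p (take-++ (map (lookup v) f) v)

  allowed⇒EO5 : ∀ {r} → Allowed S r → EO5 S r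
  allowed⇒EO5 (inj₁ r∈S)              = base r∈S
  allowed⇒EO5 (inj₂ (inj₁ refl))      = bot
  allowed⇒EO5 (inj₂ (inj₂ (i , refl))) = eq i

  ∃-∧ : ∀ {m s} {Γ : Vec (Fin k) m} {t₀ t₁} → EO5′ (s ∷ Γ) t₀ → EO5′ (s ∷ Γ) t₁ →
        ¬ Dummy (rel _ (s ∷ Γ) t₀) zero → ¬ Dummy (rel _ (s ∷ Γ) t₁) zero →
        EO5′ Γ (λ v → (t₀ (false ∷ v) ∧ t₁ (false ∷ v)) ∨ (t₀ (true ∷ v) ∧ t₁ (true ∷ v)))
  ∃-∧ {m} {Γ = Γ} {t₀} {t₁} e₀ e₁ ¬d₀ ¬d₁ =
    EO5′-cast (substitute (allFin m ++ allFin m) diagonal-sorts (comp e₀ e₁ ¬d₀ ¬d₁)) refl values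
    where
    diagonal : ∀ {A : Set} (v : Vec A m) → map (lookup v) (allFin m ++ allFin m) ≡ v ++ v
    diagonal v = trans (map-++ (lookup v) (allFin m) (allFin m))
                       (cong₂ _++_ (map-lookup-allFin v) (map-lookup-allFin v))
    diagonal-sorts : ∀ j → lookup Γ (lookup (allFin m ++ allFin m) j) ≡ lookup (Γ ++ Γ) j
    diagonal-sorts j = trans (sym (lookup-map j (lookup Γ) (allFin m ++ allFin m)))
                             (cong (λ xs → lookup xs j) (diagonal Γ))
    conj : Vec Bool m → Vec Bool m → Bool
    conj x y = (t₀ (false ∷ x) ∧ t₁ (false ∷ y)) ∨ (t₀ (true ∷ x) ∧ t₁ (true ∷ y))
    values : ∀ v → conj (take m (map (lookup v) (allFin m ++ allFin m)))
                        (drop m (map (lookup v) (allFin m ++ allFin m))) ≡ conj v v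
    values v rewrite diagonal v | take-++ v v | drop-++ v v = refl

  record Separator {m} (Γ : Vec (Fin k) m) (P : Vec Bool m → Bool) (a : Vec Bool m) : Set where
    field
      sep     : Vec Bool m → Bool
      sep-EO5 : EO5′ Γ sep
      P⊆sep   : ∀ v → P v ≡ true → sep v ≡ true
      sep-a   : sep a ≡ false

  module _ {m} {Γ : Vec (Fin k) m} where

    Separator-mono : ∀ {P Q a} → (∀ v → Q v ≡ true → P v ≡ true) →
                     Separator Γ P a → Separator Γ Q a
    Separator-mono Q⊆P σ = record
      { sep = sep ; sep-EO5 = sep-EO5 ; P⊆sep = λ v Qv → P⊆sep v (Q⊆P v Qv) ; sep-a = sep-a }
      where open Separator σ

    separate-∀ : ∀ {s P a} b → Separator (s ∷ Γ) P (b ∷ a) →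
                 Separator Γ (λ v → P (false ∷ v) ∧ P (true ∷ v)) a
    separate-∀ {a = a} b σ = record
      { sep     = λ v → sep (false ∷ v) ∧ sep (true ∷ v)
      ; sep-EO5 = univ sep-EO5
      ; P⊆sep   = λ v P∀ → cong₂ _∧_ (P⊆sep _ (∧-conicalˡ _ _ P∀))
                                     (P⊆sep _ (∧-conicalʳ _ _ P∀))
      ; sep-a   = sep-∀-a b sep-a
      }
      where
      open Separator σ
      sep-∀-a : ∀ b → sep (b ∷ a) ≡ false → sep (false ∷ a) ∧ sep (true ∷ a) ≡ false
      sep-∀-a false sep-a₀ = cong (_∧ sep (true ∷ a)) sep-a₀
      sep-∀-a true  sep-a₁ = trans (cong (sep (false ∷ a) ∧_) sep-a₁) (∧-zeroʳ _)

    separate-∃-dummy : ∀ {s P a b} (σ : Separator (s ∷ Γ) P (b ∷ a)) →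
                       Dummy (rel _ (s ∷ Γ) (Separator.sep σ)) zero →
                       Separator Γ (λ v → P (false ∷ v) ∨ P (true ∷ v)) a
    separate-∃-dummy {P = P} {a} {b} σ dummy = record
      { sep     = λ v → sep (false ∷ v)
      ; sep-EO5 = remD sep-EO5 dummy
      ; P⊆sep   = P∃⊆sep
      ; sep-a   = trans (sym (dummy (b ∷ a) false)) sep-a
      }
      where
      open Separator σ
      P∃⊆sep : ∀ v → P (false ∷ v) ∨ P (true ∷ v) ≡ true → sep (false ∷ v) ≡ true
      P∃⊆sep v P∃ with P (false ∷ v) in P₀
      ... | true  = P⊆sep _ P₀
      ... | false = trans (sym (dummy (true ∷ v) false)) (P⊆sep _ P∃)

    -- (eo4) needs non-dummy first variables; if one of the two separators has a dummy
    -- first variable, dropping it already separates.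
    separate-∃ : ∀ {s P a} →
                 Separator (s ∷ Γ) P (false ∷ a) → Separator (s ∷ Γ) P (true ∷ a) →
                 Separator Γ (λ v → P (false ∷ v) ∨ P (true ∷ v)) a
    separate-∃ {s} {P} {a} σ₀ σ₁
      with dummy? (rel _ (s ∷ Γ) (Separator.sep σ₀)) zero
         | dummy? (rel _ (s ∷ Γ) (Separator.sep σ₁)) zero
    ... | yes dummy₀ | _          = separate-∃-dummy σ₀ dummy₀
    ... | no _       | yes dummy₁ = separate-∃-dummy σ₁ dummy₁
    ... | no ¬dummy₀ | no ¬dummy₁ = record
      { sep     = λ v → (sep₀ (false ∷ v) ∧ sep₁ (false ∷ v))
                      ∨ (sep₀ (true ∷ v) ∧ sep₁ (true ∷ v))
      ; sep-EO5 = ∃-∧ sep-EO5₀ sep-EO5₁ ¬dummy₀ ¬dummy₁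
      ; P⊆sep   = P∃⊆sep
      ; sep-a   = trans (cong₂ (λ x y → (x ∧ sep₁ (false ∷ a)) ∨ (sep₀ (true ∷ a) ∧ y))
                               sep-a₀ sep-a₁)
                        (∧-zeroʳ (sep₀ (true ∷ a)))
      }
      where
      open Separator σ₀
        renaming (sep to sep₀; sep-EO5 to sep-EO5₀; P⊆sep to P⊆sep₀; sep-a to sep-a₀)
      open Separator σ₁
        renaming (sep to sep₁; sep-EO5 to sep-EO5₁; P⊆sep to P⊆sep₁; sep-a to sep-a₁)
      P∃⊆sep : ∀ v → P (false ∷ v) ∨ P (true ∷ v) ≡ true →
               ((sep₀ (false ∷ v) ∧ sep₁ (false ∷ v)) ∨ (sep₀ (true ∷ v) ∧ sep₁ (true ∷ v))) ≡ true
      P∃⊆sep v P∃ with P (false ∷ v) in P₀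
      ... | true  rewrite P⊆sep₀ _ P₀ | P⊆sep₁ _ P₀ = refl
      ... | false rewrite P⊆sep₀ _ P∃ | P⊆sep₁ _ P∃ = ∨-zeroʳ _

  separate : ∀ {m} {Γ : Vec (Fin k) m} (φ : Formula S Γ) a →
             eval φ a ≡ false → Separator Γ (eval φ) a
  separate (atom r allowed f f-sorts) a φa = record
    { sep     = λ v → pred r (map (lookup v) f)
    ; sep-EO5 = substitute f f-sorts (allowed⇒EO5 allowed)
    ; P⊆sep   = λ _ φv → φv
    ; sep-a   = φa
    }
  separate (and φ ψ) a φψa with eval φ a in φa
  ... | false = Separator-mono (λ v → ∧-conicalˡ _ _) (separate φ a φa)
  ... | true  = Separator-mono (λ v → ∧-conicalʳ (eval φ v) _) (separate ψ a φψa)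
  separate (all s φ) a φa with eval φ (false ∷ a) in φ₀
  ... | false = separate-∀ false (separate φ _ φ₀)
  ... | true  = separate-∀ true (separate φ _ φa)
  separate (ex s φ) a φa =
    separate-∃ (separate φ _ (∨-conicalˡ _ _ φa)) (separate φ _ (∨-conicalʳ _ _ φa))

  qpp⇒EO5-of-unique-falsifier : ∀ {ρ} → InQpp S ρ → HasUniqueFalsifier ρ → EO5 S ρ
  qpp⇒EO5-of-unique-falsifier {ρ} (φ , φ≗ρ) (a , ρa , unique) = EO5′-cast sep-EO5 refl sep≗ρ
    where
    open Separator (separate φ a (trans (φ≗ρ a) ρa))
    sep≗ρ : ∀ v → sep v ≡ pred ρ v
    sep≗ρ v with pred ρ v in ρv
    ... | true  = P⊆sep v (trans (φ≗ρ v) ρv)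
    ... | false = trans (cong sep (unique v ρv)) sep-a

vectorsOver : ∀ {A : Set} → List A → ∀ n → List (Vec A n)
vectorsOver xs zero    = [] ∷ᴸ []ᴸ
vectorsOver xs (suc n) = cartesianProductWith _∷_ xs (vectorsOver xs n)

∈-vectorsOver : ∀ {A : Set} {xs : List A} → (∀ x → x ∈ xs) →
                ∀ {n} (v : Vec A n) → v ∈ vectorsOver xs n
∈-vectorsOver all∈ []      = here refl
∈-vectorsOver all∈ (x ∷ v) =
  cartesianProductWith⁺ _∷_ (λ { refl refl → refl }) (all∈ x) (∈-vectorsOver all∈ v)

booleanFunctions : ∀ n → List (Vec Bool n → Bool)
booleanFunctions zero    = (λ _ → false) ∷ᴸ (λ _ → true) ∷ᴸ []ᴸ
booleanFunctions (suc n) =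
  cartesianProductWith (λ f₀ f₁ v → if head v then f₁ (tail v) else f₀ (tail v))
                       (booleanFunctions n) (booleanFunctions n)

booleanFunctions-complete : ∀ n (p : Vec Bool n → Bool) →
                            Any (λ q → ∀ v → p v ≡ q v) (booleanFunctions n)
booleanFunctions-complete zero p with p [] in p[]
... | false = here λ { [] → p[] }
... | true  = there (here λ { [] → p[] })
booleanFunctions-complete (suc n) p =
  cartesianProductWith⁺ _ (λ p₀ p₁ → λ { (false ∷ v) → p₀ v ; (true ∷ v) → p₁ v })
    (booleanFunctions-complete n λ v → p (false ∷ v))
    (booleanFunctions-complete n λ v → p (true ∷ v))

Unique⇒lookup-injective : ∀ {A : Set} {xs : List A} → Unique xs → ∀ {i j} → i < j →
                          List.lookup xs i ≢ List.lookup xs j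
Unique⇒lookup-injective (x≢xs ∷ _)  {zero}  {suc j} _         = All.lookup x≢xs (∈-lookup j)
Unique⇒lookup-injective (_ ∷ uniq) {suc i} {suc j} (s≤s i<j) = Unique⇒lookup-injective uniq i<j

Unique⇒length≤ : ∀ {k} (xs : List (Fin k)) → Unique xs → length xs ≤ k
Unique⇒length≤ xs uniq = ≮⇒≥ λ k<len →
  let _ , _ , i<j , xsᵢ≡xsⱼ = pigeonhole k<len (List.lookup xs)
  in Unique⇒lookup-injective uniq i<j xsᵢ≡xsⱼ

≈R-arity : ∀ {k} {ρ ρ′ : Rel k} → ρ ≈R ρ′ → arity ρ ≡ arity ρ′
≈R-arity (mk≈ _) = refl

canonical-arity≤ : ∀ {k} {ρ : Rel k} → Canonical ρ → ¬ IsC7 ρ → arity ρ ≤ 4 + k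
canonical-arity≤ {k} canonical@(_ , r , basic , π , ρ≈) ¬c7 =
  subst (_≤ 4 + k) (sym (≈R-arity ρ≈))
        (basic-arity≤ basic λ B uniq r≡ → ¬c7 (canonical , r , (B , uniq , r≡) , π , ρ≈))
  where
  basic-arity≤ : ∀ {r} → Basic r → (∀ B → Unique (List.map proj₁ B) → ¬ r ≡ C7 B) →
                 arity r ≤ 4 + k
  basic-arity≤ (c1 _)         _   = s≤s (s≤s z≤n)
  basic-arity≤ (c2 _ _ _)     _   = s≤s (s≤s (s≤s z≤n))
  basic-arity≤ (c3a _ _ _)    _   = m≤m+n 4 k
  basic-arity≤ (c3b _)        _   = s≤s (s≤s (s≤s z≤n))
  basic-arity≤ (c4 _)         _   = s≤s (s≤s z≤n)
  basic-arity≤ (c5 _ _)       _   = m≤m+n 4 k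
  basic-arity≤ (c6 L _ _ uniq) _  = ≤-trans (Unique⇒length≤ L uniq) (m≤n+m k 4)
  basic-arity≤ (c7 B uniq)    ¬c7 = ⊥-elim (¬c7 B uniq refl)

relationsOfArity : ∀ {k} n → List (Rel k)
relationsOfArity {k} n =
  cartesianProductWith (rel n) (vectorsOver (List.allFin k) n) (booleanFunctions n)

relationsOfArity≤ : ∀ {k} → ℕ → List (Rel k)
relationsOfArity≤ N = concatMap relationsOfArity (upTo (suc N))

relationsOfArity≤-complete : ∀ {k} N (ρ : Rel k) → arity ρ ≤ N → Any (ρ ≈R_) (relationsOfArity≤ N)
relationsOfArity≤-complete N (rel n ss p) n≤N =
  concatMap⁺ relationsOfArity (Any.map (λ { refl → ρ∈ }) (∈-upTo⁺ (s≤s n≤N)))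
  where
  ρ∈ : Any (rel n ss p ≈R_) (relationsOfArity n)
  ρ∈ = cartesianProductWith⁺ (rel n) (λ { refl p≗q → mk≈ p≗q })
                             (∈-vectorsOver ∈-allFin ss) (booleanFunctions-complete n p)

theorem4p7 : (k : ℕ) (S : Rel k → Set) →
    ((ρ : Rel k) → Canonical ρ → InQpp S ρ → ¬ EO5 S ρ → ¬ IsC7 ρ)
    × Σ (List (Rel k)) (λ L →
        (ρ : Rel k) → Canonical ρ → InQpp S ρ → ¬ EO5 S ρ → Any (ρ ≈R_) L)
theorem4p7 k S = not-c7 , relationsOfArity≤ (4 + k) , λ ρ canonical qpp ¬eo5 →
  relationsOfArity≤-complete (4 + k) ρ (canonical-arity≤ canonical (not-c7 ρ canonical qpp ¬eo5))
  where
  not-c7 : (ρ : Rel k) → Canonical ρ → InQpp S ρ → ¬ EO5 S ρ → ¬ IsC7 ρ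
  not-c7 ρ _ qpp ¬eo5 isC7 =
    ¬eo5 (qpp⇒EO5-of-unique-falsifier S qpp (IsC7⇒HasUniqueFalsifier isC7))
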